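{- In the labelled calculus $\mathsf{G3I}$, the rules $\supset_{L'}$: from $\mathcal{R},X,x\!:\!A\supset B\vdash x\!:\!A,Y$ and $\mathcal{R},X,x\!:\!B\vdash Y$ infer $\mathcal{R},X,x\!:\!A\supset B\vdash Y$, and $\mathsf{init}'$: the zero-premise rule with conclusion $\mathcal{R},X,x\!:\!P\vdash Y,x\!:\!P$ ($P$ atomic), are derivable up to weakening. Moreover, the rule $\mathtt{lift}'$: from $\mathcal{R},x\leq y,X,y\!:\!A\vdash Y$ infer $\mathcal{R},x\leq y,X,x\!:\!A\vdash Y$, is admissible in $\mathsf{G3I}$.
   Context: $\mathsf{G3I}$ is the labelled sequent calculus for intuitionistic propositional logic based on Kripke semantics. Its sequents are $\mathcal{R},X\vdash Y$ where $\mathcal{R}$ is a multiset of relational atoms $x\leq y$ between state variables and $X,Y$ are multisets of labelled formulae $x\!:\!A$ (read as "$x$ forces $A$"). Its rules include: $\supset_L^t$: from $\mathcal{R},x\leq y,X,x\!:\!A\supset B\vdash y\!:\!A,Y$ and $\mathcal{R},x\leq y,X,y\!:\!B\vdash Y$ infer $\mathcal{R},x\leq y,X,x\!:\!A\supset B\vdash Y$; $\supset_R^t$: from $\mathcal{R},x\leq y,X,y\!:\!A\vdash Y,y\!:\!B$ infer $\mathcal{R},X\vdash Y,x\!:\!A\supset B$, with $y$ fresh; $\mathsf{init}^t$: $\mathcal{R},X,x\leq y,x\!:\!P\vdash Y,y\!:\!P$ for atomic $P$; Ref: from $x\leq x,\mathcal{R},X\vdash Y$ infer $\mathcal{R},X\vdash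 Y$; Trans: from $x\leq z,x\leq y,y\leq z,\mathcal{R},X\vdash Y$ infer $x\leq y,y\leq z,\mathcal{R},X\vdash Y$; together with the standard labelled rules for $\land,\lor$ and $\bot$ acting on formulae with a single label (e.g. $\mathcal{R},X,x\!:\!A\land B\vdash Y$ from $\mathcal{R},X,x\!:\!A,x\!:\!B\vdash Y$; $\mathcal{R},X,x\!:\!\bot\vdash Y$ is an axiom). "Derivable up to weakening" means the conclusion is derivable from premises that may contain additional (weakened) labelled formulae or relational atoms. -}

module Defs where

open import Data.Nat using (ℕ)
open import Data.List using (List; []; _∷_; _++_; concatMap)
open import Data.List.Membership.Propositional using (_∈_; _∉_)
open import Data.List.Relation.Binary.Permutation.Propositional using (_↭_)
open import Data.Product using (Σ; ∃; _×_; _,_)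
open import Data.Empty using (⊥)
open import Relation.Binary.PropositionalEquality using (_≡_)

data Fm : Set where
  atom : ℕ → Fm
  ⊥'   : Fm
  _∧'_ : Fm → Fm → Fm
  _∨'_ : Fm → Fm → Fm
  _⊃_  : Fm → Fm → Fm

infixr 6 _∧'_
infixr 5 _∨'_
infixr 4 _⊃_

Label : Set
Label = ℕ

record RelAt : Set where
  constructor _≼_
  field
    lo hi : Label

record LFm : Set where
  constructor _∶_
  field
    lab : Label
    fm  : Fm

infix 7 _≼_
infix 2 _∶_

-- Multisets are represented as lists; an explicit
-- exchange rule (closure under permutation of each component) makes
-- derivability insensitive to the order, i.e. sequents are multisets.
record Seq : Set where
  constructor ⟨_,_⊢_⟩
  field
    rels : List RelAt
    ant  : List LFm
    suc  : List LFm

labsR : List RelAt → List Label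
labsR []              = []
labsR ((x ≼ y) ∷ R)   = x ∷ y ∷ labsR R

labsF : List LFm → List Label
labsF []              = []
labsF ((x ∶ A) ∷ X)   = x ∷ labsF X

labsS : Seq → List Label
labsS ⟨ R , X ⊢ Y ⟩ = labsR R ++ labsF X ++ labsF Y

-- Derivations in G3I, from a family of open assumptions (leaves) H.
-- G3I-derivability proper is  Der NoHyp.
data Der (H : Seq → Set) : Seq → Set where
  hyp   : ∀ {S} → H S → Der H S
  exch  : ∀ {R R' X X' Y Y'} → R ↭ R' → X ↭ X' → Y ↭ Y' →
          Der H ⟨ R , X ⊢ Y ⟩ → Der H ⟨ R' , X' ⊢ Y' ⟩
  initᵗ : ∀ {R X Y x y P} →
          Der H ⟨ (x ≼ y) ∷ R , (x ∶ atom P) ∷ X ⊢ (y ∶ atom P) ∷ Y ⟩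
  ⊥L    : ∀ {R X Y x} → Der H ⟨ R , (x ∶ ⊥') ∷ X ⊢ Y ⟩
  ∧L    : ∀ {R X Y x A B} →
          Der H ⟨ R , (x ∶ A) ∷ (x ∶ B) ∷ X ⊢ Y ⟩ →
          Der H ⟨ R , (x ∶ A ∧' B) ∷ X ⊢ Y ⟩
  ∧R    : ∀ {R X Y x A B} →
          Der H ⟨ R , X ⊢ (x ∶ A) ∷ Y ⟩ →
          Der H ⟨ R , X ⊢ (x ∶ B) ∷ Y ⟩ →
          Der H ⟨ R , X ⊢ (x ∶ A ∧' B) ∷ Y ⟩
  ∨L    : ∀ {R X Y x A B} →
          Der H ⟨ R , (x ∶ A) ∷ X ⊢ Y ⟩ →
          Der H ⟨ R , (x ∶ B) ∷ X ⊢ Y ⟩ →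
          Der H ⟨ R , (x ∶ A ∨' B) ∷ X ⊢ Y ⟩
  ∨R    : ∀ {R X Y x A B} →
          Der H ⟨ R , X ⊢ (x ∶ A) ∷ (x ∶ B) ∷ Y ⟩ →
          Der H ⟨ R , X ⊢ (x ∶ A ∨' B) ∷ Y ⟩
  ⊃Lᵗ   : ∀ {R X Y x y A B} →
          Der H ⟨ (x ≼ y) ∷ R , (x ∶ A ⊃ B) ∷ X ⊢ (y ∶ A) ∷ Y ⟩ →
          Der H ⟨ (x ≼ y) ∷ R , (y ∶ B) ∷ X ⊢ Y ⟩ →
          Der H ⟨ (x ≼ y) ∷ R , (x ∶ A ⊃ B) ∷ X ⊢ Y ⟩
  ⊃Rᵗ   : ∀ {R X Y x y A B} →
          y ∉ x ∷ labsS ⟨ R , X ⊢ Y ⟩ →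
          Der H ⟨ (x ≼ y) ∷ R , (y ∶ A) ∷ X ⊢ (y ∶ B) ∷ Y ⟩ →
          Der H ⟨ R , X ⊢ (x ∶ A ⊃ B) ∷ Y ⟩
  Ref   : ∀ {R X Y x} →
          Der H ⟨ (x ≼ x) ∷ R , X ⊢ Y ⟩ →
          Der H ⟨ R , X ⊢ Y ⟩
  Trans : ∀ {R X Y x y z} →
          Der H ⟨ (x ≼ z) ∷ (x ≼ y) ∷ (y ≼ z) ∷ R , X ⊢ Y ⟩ →
          Der H ⟨ (x ≼ y) ∷ (y ≼ z) ∷ R , X ⊢ Y ⟩

NoHyp : Seq → Set
NoHyp _ = ⊥

G3I⊢ : Seq → Set
G3I⊢ = Der NoHyp

-- S' is a weakening of S: S' extends S by additional relational atoms
-- and labelled formulae (order irrelevant thanks to the exchange rule).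
Weakening : Seq → Seq → Set
Weakening ⟨ R , X ⊢ Y ⟩ S' =
  Σ (List RelAt) λ R' → Σ (List LFm) λ X' → Σ (List LFm) λ Y' →
    S' ≡ ⟨ R ++ R' , X ++ X' ⊢ Y ++ Y' ⟩

WeakOf : List Seq → Seq → Set
WeakOf Ps S = Σ Seq λ P → P ∈ Ps × Weakening P S

-- A rule with premises Ps and conclusion C is derivable up to weakening
-- in G3I: C has a G3I derivation whose open leaves are weakenings of
-- premises in Ps.
DerivableUpToWeakening : List Seq → Seq → Set
DerivableUpToWeakening Ps C = Der (WeakOf Ps) C

module Submission where

-- The two rules ⊃L′ and init′ are the "reflexive instances" of ⊃Lᵗ and initᵗ:
-- adding the atom x ≤ x by Ref turns them into instances of the primitive
-- rules.  init′ then has no open leaves; for ⊃L′ the extra atom is absorbed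
-- by weakening its two premises.
--
-- Admissibility of lift′ is the real content.  It is the case of a single
-- formula of a stronger statement proved by induction on G3I derivations
-- (`lift-many`): in a derivation of  R , X ⊢ Y  one may
--   * enlarge R to any R′ ⊇ R whose labels already occur in the sequent
--     (this keeps every ⊃Rᵗ eigenvariable fresh), and
--   * simultaneously replace antecedent formulae  y : A  by  x : A  for
--     atoms  x ≤ y  of R′ (several formulae at once, since ∧L splits one
--     lifted formula into two).
-- Atoms are read up to membership, so the premises of Ref and Trans, which
-- repeat atoms, stay inside R′.  The only cases that change the derivation
-- are initᵗ and ⊃Lᵗ on a lifted formula: x ≤ y and y ≤ z give x ≤ z by an
-- extra Trans step.  Since the atoms used lie anywhere in R′, these cases
-- use versions of initᵗ, ⊃Lᵗ and Trans acting on any member of the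
-- relational context (obtained by exchange).

open import Defs
open import Data.Nat using (ℕ; _≟_)
open import Data.List using (List; []; _∷_; _++_)
open import Data.List.Properties using (++-identityʳ)
open import Data.Product using (_×_; _,_; ∃)
open import Data.Sum using (_⊎_; inj₁; inj₂; [_,_])
open import Data.Empty using (⊥-elim)
open import Function using (_∘_; _$_)
open import Relation.Nullary using (yes; no)
open import Relation.Binary.PropositionalEquality using (_≢_; refl; sym; cong)
open import Data.List.Relation.Unary.Any using (here; there)
open import Data.List.Membership.Propositional using (_∈_; _∉_)
open import Data.List.Membership.Propositional.Properties using (∈-∃++; ∈-++⁻)
open import Data.List.Relation.Binary.Subset.Propositional using (_⊆_)
open import Data.List.Relation.Binary.Subset.Propositional.Properties
  using (⊆-refl; ⊆-trans; ⊆-reflexive-↭; xs⊆x∷xs; ∷⁺ʳ; ∈-∷⁺ʳ; xs⊆xs++ys; xs⊆ys++xs; ++⁺)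
open import Data.List.Relation.Binary.Permutation.Propositional
  using (_↭_; prep; swap; ↭-refl; ↭-sym; ↭-trans; ↭-reflexive)
open import Data.List.Relation.Binary.Permutation.Propositional.Properties
  using (∈-resp-↭; shift; ∷↭∷ʳ)
open import Data.List.Relation.Binary.Pointwise as Pointwise using (Pointwise; []; _∷_)

lo∈labsR : ∀ {x y R} → (x ≼ y) ∈ R → x ∈ labsR R
lo∈labsR {R = _ ∷ _} (here refl) = here refl
lo∈labsR {R = _ ∷ _} (there p)   = there (there (lo∈labsR p))

hi∈labsR : ∀ {x y R} → (x ≼ y) ∈ R → y ∈ labsR R
hi∈labsR {R = _ ∷ _} (here refl) = there (here refl)
hi∈labsR {R = _ ∷ _} (there p)   = there (there (hi∈labsR p))

lab∈labsF : ∀ {x A X} → (x ∶ A) ∈ X → x ∈ labsF X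
lab∈labsF {X = _ ∷ _} (here refl) = here refl
lab∈labsF {X = _ ∷ _} (there p)   = there (lab∈labsF p)

labsR-mono : ∀ {R R₀} → R ⊆ R₀ → labsR R ⊆ labsR R₀
labsR-mono {_ ∷ _} sub (here refl)         = lo∈labsR (sub (here refl))
labsR-mono {_ ∷ _} sub (there (here refl)) = hi∈labsR (sub (here refl))
labsR-mono {_ ∷ _} sub (there (there p))   = labsR-mono (sub ∘ there) p

labsF-mono : ∀ {X X₀} → X ⊆ X₀ → labsF X ⊆ labsF X₀
labsF-mono {_ ∷ _} sub (here refl) = lab∈labsF (sub (here refl))
labsF-mono {_ ∷ _} sub (there p)   = labsF-mono (sub ∘ there) p

record _⊑_ (S T : Seq) : Set where
  constructor labels⊆
  field
    ⊑-labels : labsS S ⊆ labsS T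
open _⊑_

inR : ∀ R X Y → labsR R ⊆ labsS ⟨ R , X ⊢ Y ⟩
inR R _ _ = xs⊆xs++ys (labsR R) _

inX : ∀ R X Y → labsF X ⊆ labsS ⟨ R , X ⊢ Y ⟩
inX R X _ = xs⊆ys++xs _ (labsR R) ∘ xs⊆xs++ys (labsF X) _

inY : ∀ R X Y → labsF Y ⊆ labsS ⟨ R , X ⊢ Y ⟩
inY R X _ = xs⊆ys++xs _ (labsR R) ∘ xs⊆ys++xs _ (labsF X)

labsS-⊆ : ∀ {R X Y L} → labsR R ⊆ L → labsF X ⊆ L → labsF Y ⊆ L →
          labsS ⟨ R , X ⊢ Y ⟩ ⊆ L
labsS-⊆ {R} {X} r x y p with ∈-++⁻ (labsR R) p
... | inj₁ q = r q
... | inj₂ q = [ x , y ] (∈-++⁻ (labsF X) q)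

⊑-parts : ∀ {R X Y R₁ X₁ Y₁} →
          labsR R ⊆ labsR R₁ → labsF X ⊆ labsF X₁ → labsF Y ⊆ labsF Y₁ →
          ⟨ R , X ⊢ Y ⟩ ⊑ ⟨ R₁ , X₁ ⊢ Y₁ ⟩
⊑-parts r x y = labels⊆ (++⁺ r (++⁺ x y))

extended : ∀ {A : Set} {x : A} {xs} → xs ⊆ x ∷ xs
extended = xs⊆x∷xs _ _

doubled : ∀ {A : Set} {x : A} {xs} → x ∷ xs ⊆ x ∷ x ∷ xs
doubled = ∷⁺ʳ _ extended

⊑-↭ : ∀ {R X Y R₁ X₁ Y₁} → R ↭ R₁ → X ↭ X₁ → Y ↭ Y₁ →
      ⟨ R , X ⊢ Y ⟩ ⊑ ⟨ R₁ , X₁ ⊢ Y₁ ⟩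
⊑-↭ r x y = ⊑-parts (labsR-mono (⊆-reflexive-↭ r))
                    (labsF-mono (⊆-reflexive-↭ x)) (labsF-mono (⊆-reflexive-↭ y))

⊑-moreRel : ∀ {r R X Y} → ⟨ R , X ⊢ Y ⟩ ⊑ ⟨ r ∷ R , X ⊢ Y ⟩
⊑-moreRel {r} {R} {X} {Y} =
  ⊑-parts {R} {X} {Y} {r ∷ R} {X} {Y} (⊆-trans extended extended) ⊆-refl ⊆-refl

⊑-⊃L : ∀ {R X Y x y F G} →
       ⟨ (x ≼ y) ∷ R , (x ∶ F) ∷ X ⊢ Y ⟩ ⊑ ⟨ (x ≼ y) ∷ R , (y ∶ G) ∷ X ⊢ Y ⟩
⊑-⊃L {R} {X} {Y} {x} {y} {F} {G} = labels⊆ $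
  labsS-⊆ {R₁} {(x ∶ F) ∷ X} {Y}
    (inR R₁ X₁ Y) (∈-∷⁺ʳ (inR R₁ X₁ Y (here refl)) (inX R₁ X₁ Y ∘ there)) (inY R₁ X₁ Y)
  where R₁ = (x ≼ y) ∷ R
        X₁ = (y ∶ G) ∷ X

⊑-⊃R : ∀ {R X Y x y F G H} →
       ⟨ R , X ⊢ (x ∶ F) ∷ Y ⟩ ⊑ ⟨ (x ≼ y) ∷ R , (y ∶ G) ∷ X ⊢ (y ∶ H) ∷ Y ⟩
⊑-⊃R {R} {X} {Y} {x} {y} {F} {G} {H} = labels⊆ $
  labsS-⊆ {R} {X} {(x ∶ F) ∷ Y}
    (inR R₁ X₁ Y₁ ∘ there ∘ there) (inX R₁ X₁ Y₁ ∘ there)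
    (∈-∷⁺ʳ (inR R₁ X₁ Y₁ (here refl)) (inY R₁ X₁ Y₁ ∘ there))
  where R₁ = (x ≼ y) ∷ R
        X₁ = (y ∶ G) ∷ X
        Y₁ = (y ∶ H) ∷ Y

pull : ∀ {R X Y x F} → labsS ⟨ R , X ⊢ (x ∶ F) ∷ Y ⟩ ⊆ x ∷ labsS ⟨ R , X ⊢ Y ⟩
pull {R} {X} {Y} {x} {F} =
  labsS-⊆ {R} {X} {(x ∶ F) ∷ Y} (there ∘ inR R X Y) (there ∘ inX R X Y)
    (∈-∷⁺ʳ (here refl) (there ∘ inY R X Y))

-- Since sequents are multisets, a member of R can be brought to the front;
-- this gives initᵗ, ⊃Lᵗ and Trans for atoms anywhere in the context.
pick : ∀ {r : RelAt} {R} → r ∈ R → ∃ λ R₁ → R ↭ r ∷ R₁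
pick r∈ with R₀ , R₁ , refl ← ∈-∃++ r∈ = R₀ ++ R₁ , shift _ R₀ R₁

pick₂ : ∀ {r s : RelAt} {R} → r ∈ R → s ∈ R → r ≢ s → ∃ λ R₂ → R ↭ r ∷ s ∷ R₂
pick₂ r∈ s∈ r≢s with R₁ , p ← pick r∈ with ∈-resp-↭ p s∈
... | here s≡r = ⊥-elim (r≢s (sym s≡r))
... | there s∈R₁ with R₂ , q ← pick s∈R₁ = R₂ , ↭-trans p (prep _ q)

rearrange : ∀ {H R R₀ X Y} → R ↭ R₀ → Der H ⟨ R , X ⊢ Y ⟩ → Der H ⟨ R₀ , X ⊢ Y ⟩
rearrange p = exch p ↭-refl ↭-refl

init∈ : ∀ {H R X Y x y P} → (x ≼ y) ∈ R →
        Der H ⟨ R , (x ∶ atom P) ∷ X ⊢ (y ∶ atom P) ∷ Y ⟩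
init∈ x≼y∈ with _ , p ← pick x≼y∈ = rearrange (↭-sym p) initᵗ

⊃L∈ : ∀ {H R X Y x y A B} → (x ≼ y) ∈ R →
      Der H ⟨ R , (x ∶ A ⊃ B) ∷ X ⊢ (y ∶ A) ∷ Y ⟩ → Der H ⟨ R , (y ∶ B) ∷ X ⊢ Y ⟩ →
      Der H ⟨ R , (x ∶ A ⊃ B) ∷ X ⊢ Y ⟩
⊃L∈ x≼y∈ d e with _ , p ← pick x≼y∈ =
  rearrange (↭-sym p) (⊃Lᵗ (rearrange p d) (rearrange p e))

-- Trans needs two distinct occurrences; x ≢ y ensures x ≤ y and y ≤ z differ.
trans∈ : ∀ {H R X Y x y z} → (x ≼ y) ∈ R → (y ≼ z) ∈ R → x ≢ y →
         Der H ⟨ (x ≼ z) ∷ R , X ⊢ Y ⟩ → Der H ⟨ R , X ⊢ Y ⟩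
trans∈ x≼y∈ y≼z∈ x≢y d with _ , p ← pick₂ x≼y∈ y≼z∈ (x≢y ∘ cong RelAt.lo) =
  rearrange (↭-sym p) (Trans (rearrange (prep _ p) d))

-- The
-- second clause guarantees that eigenvariables of ⊃Rᵗ stay fresh.
record Enlargement (R′ : List RelAt) (S : Seq) : Set where
  constructor enlargement
  field
    covers : Seq.rels S ⊆ R′
    known  : labsR R′ ⊆ labsS S
open Enlargement

narrow : ∀ {R′ S S₁} → Enlargement R′ S → S ⊑ S₁ → Seq.rels S₁ ⊆ R′ →
         Enlargement R′ S₁
narrow e S⊑S₁ covers₁ = enlargement covers₁ (⊆-trans (known e) (⊑-labels S⊑S₁))

to-premise : ∀ {R′ R X Y X₁ Y₁} → Enlargement R′ ⟨ R , X ⊢ Y ⟩ →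
             ⟨ R , X ⊢ Y ⟩ ⊑ ⟨ R , X₁ ⊢ Y₁ ⟩ → Enlargement R′ ⟨ R , X₁ ⊢ Y₁ ⟩
to-premise e S⊑S₁ = narrow e S⊑S₁ (covers e)

extend : ∀ {R′ S S₁ x y} → Enlargement R′ S → S ⊑ S₁ →
         Seq.rels S₁ ⊆ (x ≼ y) ∷ R′ → x ∈ labsS S₁ → y ∈ labsS S₁ →
         Enlargement ((x ≼ y) ∷ R′) S₁
extend e S⊑S₁ covers₁ x∈ y∈ =
  enlargement covers₁ (∈-∷⁺ʳ x∈ (∈-∷⁺ʳ y∈ (⊆-trans (known e) (⊑-labels S⊑S₁))))

extend-trans : ∀ {R′ S S₁ x y z} → Enlargement R′ S → S ⊑ S₁ →
               Seq.rels S₁ ⊆ (x ≼ z) ∷ R′ → (x ≼ y) ∈ R′ → (y ≼ z) ∈ R′ →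
               Enlargement ((x ≼ z) ∷ R′) S₁
extend-trans e S⊑S₁ covers₁ x≼y∈ y≼z∈ =
  extend e S⊑S₁ covers₁ (⊑-labels S⊑S₁ (known e (lo∈labsR x≼y∈)))
                        (⊑-labels S⊑S₁ (known e (hi∈labsR y≼z∈)))

data Below (R′ : List RelAt) : Label → Label → Set where
  refl≤ : ∀ {x} → Below R′ x x
  step  : ∀ {x y} → (x ≼ y) ∈ R′ → x ≢ y → Below R′ x y

data Lowered (R′ : List RelAt) : LFm → LFm → Set where
  lowered : ∀ {x y A} → Below R′ x y → Lowered R′ (y ∶ A) (x ∶ A)

Lift : List RelAt → List LFm → List LFm → Set
Lift R′ = Pointwise (Lowered R′)

Lift-mono : ∀ {R′ R″ X X′} → R′ ⊆ R″ → Lift R′ X X′ → Lift R″ X X′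
Lift-mono sub = Pointwise.map λ where
  (lowered refl≤)        → lowered refl≤
  (lowered (step m x≢y)) → lowered (step (sub m) x≢y)

Lift-↭ : ∀ {R′ X₀ X X′} → X₀ ↭ X → Lift R′ X X′ →
         ∃ λ X₀′ → Lift R′ X₀ X₀′ × X₀′ ↭ X′
Lift-↭ _↭_.refl l = _ , l , ↭-refl
Lift-↭ (prep _ p) (u ∷ l) =
  let _ , l₀ , q = Lift-↭ p l in _ , u ∷ l₀ , prep _ q
Lift-↭ (swap _ _ p) (u ∷ v ∷ l) =
  let _ , l₀ , q = Lift-↭ p l in _ , v ∷ u ∷ l₀ , swap _ _ q
Lift-↭ (_↭_.trans p q) l =
  let _ , l₁ , q′ = Lift-↭ q l
      _ , l₀ , p′ = Lift-↭ p l₁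
  in _ , l₀ , ↭-trans p′ q′

lifted-labels : ∀ {R′ X X′ l} → Lift R′ X X′ → l ∈ labsF X′ → l ∈ labsF X ⊎ l ∈ labsR R′
lifted-labels (lowered refl≤ ∷ _)      (here refl) = inj₁ (here refl)
lifted-labels (lowered (step m _) ∷ _) (here refl) = inj₂ (lo∈labsR m)
lifted-labels (_ ∷ l) (there p) with lifted-labels l p
... | inj₁ q = inj₁ (there q)
... | inj₂ q = inj₂ q

lifted⊑ : ∀ {R X Y R′ X′} → Enlargement R′ ⟨ R , X ⊢ Y ⟩ → Lift R′ X X′ →
          ⟨ R′ , X′ ⊢ Y ⟩ ⊑ ⟨ R , X ⊢ Y ⟩
lifted⊑ {R} {X} {Y} e l = labels⊆ $
  labsS-⊆ (known e) (λ p → [ inX R X Y , known e ] (lifted-labels l p)) (inY R X Y)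

lifted-fresh : ∀ {R X Y R′ X′ x w F} → Enlargement R′ ⟨ R , X ⊢ (x ∶ F) ∷ Y ⟩ →
               Lift R′ X X′ → w ∉ x ∷ labsS ⟨ R , X ⊢ Y ⟩ → w ∉ x ∷ labsS ⟨ R′ , X′ ⊢ Y ⟩
lifted-fresh {R} {X} {Y} {R′} {X′} {x} {w} {F} e l fresh =
  fresh ∘ ∈-∷⁺ʳ (here refl)
            (pull {R} {X} {Y} {x} {F} ∘ ⊑-labels (lifted⊑ e l) ∘ ⊑-labels weakenedY)
  where
    weakenedY : ⟨ R′ , X′ ⊢ Y ⟩ ⊑ ⟨ R′ , X′ ⊢ (x ∶ F) ∷ Y ⟩
    weakenedY = ⊑-parts ⊆-refl ⊆-refl extended

lift-many : ∀ {R X Y R′ X′} → G3I⊢ ⟨ R , X ⊢ Y ⟩ →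
            Enlargement R′ ⟨ R , X ⊢ Y ⟩ → Lift R′ X X′ → G3I⊢ ⟨ R′ , X′ ⊢ Y ⟩
lift-many (hyp ())
lift-many (exch pR pX pY d) e l =
  let _ , l₀ , q = Lift-↭ pX l
      e₀ = narrow e (⊑-↭ (↭-sym pR) (↭-sym pX) (↭-sym pY))
                    (⊆-trans (⊆-reflexive-↭ pR) (covers e))
  in exch ↭-refl q pY (lift-many d e₀ l₀)
lift-many initᵗ e (lowered refl≤ ∷ _) = init∈ (covers e (here refl))
lift-many initᵗ e (lowered (step x≼y∈ x≢y) ∷ _) =
  trans∈ x≼y∈ (covers e (here refl)) x≢y initᵗ
lift-many ⊥L _ (lowered _ ∷ _) = ⊥L
lift-many (∧L d) e (lowered b ∷ l) =
  ∧L (lift-many d (to-premise e (⊑-parts ⊆-refl doubled ⊆-refl))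
                  (lowered b ∷ lowered b ∷ l))
lift-many (∧R d₁ d₂) e l =
  ∧R (lift-many d₁ (to-premise e (⊑-parts ⊆-refl ⊆-refl ⊆-refl)) l)
     (lift-many d₂ (to-premise e (⊑-parts ⊆-refl ⊆-refl ⊆-refl)) l)
lift-many (∨L d₁ d₂) e (lowered b ∷ l) =
  ∨L (lift-many d₁ (to-premise e (⊑-parts ⊆-refl ⊆-refl ⊆-refl)) (lowered b ∷ l))
     (lift-many d₂ (to-premise e (⊑-parts ⊆-refl ⊆-refl ⊆-refl)) (lowered b ∷ l))
lift-many (∨R d) e l =
  ∨R (lift-many d (to-premise e (⊑-parts ⊆-refl ⊆-refl doubled)) l)
lift-many (⊃Lᵗ d₁ d₂) e (lowered refl≤ ∷ l) =
  ⊃L∈ (covers e (here refl))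
      (lift-many d₁ (to-premise e (⊑-parts ⊆-refl ⊆-refl extended)) (lowered refl≤ ∷ l))
      (lift-many d₂ (to-premise e ⊑-⊃L) (lowered refl≤ ∷ l))
-- A lowered  x : A ⊃ B  with  x ≤ y ≤ z : apply ⊃Lᵗ to x ≤ z, obtained by Trans.
lift-many (⊃Lᵗ d₁ d₂) e (lowered (step x≼y∈ x≢y) ∷ l) =
  trans∈ x≼y∈ y≼z∈ x≢y
    (⊃Lᵗ (lift-many d₁ (extend-trans e (⊑-parts ⊆-refl ⊆-refl extended) covers′ x≼y∈ y≼z∈)
                       (lowered (step (there x≼y∈) x≢y) ∷ Lift-mono extended l))
         (lift-many d₂ (extend-trans e ⊑-⊃L covers′ x≼y∈ y≼z∈)
                       (lowered refl≤ ∷ Lift-mono extended l)))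
  where
    y≼z∈ = covers e (here refl)
    covers′ = ⊆-trans (covers e) extended
lift-many (⊃Rᵗ fresh d) e l =
  ⊃Rᵗ (lifted-fresh e l fresh)
      (lift-many d (extend e ⊑-⊃R (∷⁺ʳ _ (covers e)) (here refl) (there (here refl)))
                   (lowered refl≤ ∷ Lift-mono extended l))
lift-many (Ref d) e l =
  Ref (lift-many d (extend e ⊑-moreRel (∷⁺ʳ _ (covers e)) (here refl) (here refl))
                   (Lift-mono extended l))
-- For  x ≤ y , y ≤ z  in R′ the atom x ≤ z is added by Trans, unless x = y,
-- in which case x ≤ z is already in R′.
lift-many (Trans {x = x} {y = y} d) e l with x ≟ y
... | yes refl = lift-many d (narrow e ⊑-moreRel (∈-∷⁺ʳ y≼z∈ (covers e))) l
  where y≼z∈ = covers e (there (here refl))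
... | no x≢y =
  trans∈ x≼y∈ y≼z∈ x≢y
    (lift-many d (extend-trans e ⊑-moreRel (∷⁺ʳ _ (covers e)) x≼y∈ y≼z∈)
                 (Lift-mono extended l))
  where
    x≼y∈ = covers e (here refl)
    y≼z∈ = covers e (there (here refl))

lift′ : (R : List RelAt) (X Y : List LFm) (x y : Label) (A : Fm) →
        G3I⊢ ⟨ (x ≼ y) ∷ R , (y ∶ A) ∷ X ⊢ Y ⟩ → G3I⊢ ⟨ (x ≼ y) ∷ R , (x ∶ A) ∷ X ⊢ Y ⟩
lift′ R X Y x y A d with x ≟ y
... | yes refl = d
... | no x≢y =
  lift-many d (enlargement ⊆-refl (inR ((x ≼ y) ∷ R) ((y ∶ A) ∷ X) Y))
              (lowered (step (here refl) x≢y) ∷ Pointwise.refl (lowered refl≤))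

leaf : ∀ {Ps R X Y} r → ⟨ R , X ⊢ Y ⟩ ∈ Ps → Der (WeakOf Ps) ⟨ r ∷ R , X ⊢ Y ⟩
leaf {R = R} {X} {Y} r P∈ =
  exch (↭-sym (∷↭∷ʳ r R)) (↭-reflexive (++-identityʳ X)) (↭-reflexive (++-identityʳ Y))
       (hyp (_ , P∈ , r ∷ [] , [] , [] , refl))

init′ : (R : List RelAt) (X Y : List LFm) (x : Label) (P : ℕ) →
        DerivableUpToWeakening [] ⟨ R , (x ∶ atom P) ∷ X ⊢ (x ∶ atom P) ∷ Y ⟩
init′ R X Y x P = Ref {x = x} initᵗ

⊃L′ : (R : List RelAt) (X Y : List LFm) (x : Label) (A B : Fm) →
      DerivableUpToWeakening
        (⟨ R , (x ∶ A ⊃ B) ∷ X ⊢ (x ∶ A) ∷ Y ⟩ ∷ ⟨ R , (x ∶ B) ∷ X ⊢ Y ⟩ ∷ [])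
        ⟨ R , (x ∶ A ⊃ B) ∷ X ⊢ Y ⟩
⊃L′ R X Y x A B = Ref (⊃Lᵗ (leaf (x ≼ x) (here refl)) (leaf (x ≼ x) (there (here refl))))

lemma2 : ((R : List RelAt) (X Y : List LFm) (x : Label) (A B : Fm) →
           DerivableUpToWeakening
             (⟨ R , (x ∶ A ⊃ B) ∷ X ⊢ (x ∶ A) ∷ Y ⟩ ∷ ⟨ R , (x ∶ B) ∷ X ⊢ Y ⟩ ∷ [])
             ⟨ R , (x ∶ A ⊃ B) ∷ X ⊢ Y ⟩)
       × ((R : List RelAt) (X Y : List LFm) (x : Label) (P : ℕ) →
           DerivableUpToWeakening [] ⟨ R , (x ∶ atom P) ∷ X ⊢ (x ∶ atom P) ∷ Y ⟩)
       × ((R : List RelAt) (X Y : List LFm) (x y : Label) (A : Fm) →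
           G3I⊢ ⟨ (x ≼ y) ∷ R , (y ∶ A) ∷ X ⊢ Y ⟩ →
           G3I⊢ ⟨ (x ≼ y) ∷ R , (x ∶ A) ∷ X ⊢ Y ⟩)
lemma2 = ⊃L′ , init′ , lift′
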